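{- Let $\mathbf A$ be an SBP-algebra. Then the poset $(\mathcal S(\mathbf A),\subseteq)$ of prime filters of $\mathbf A$ is order-isomorphic to $(\mathcal F_{\mathbf A}^{\bowtie},\sqsubseteq)$.
   Context: **SBP-algebras.** An MTL-algebra is a bounded commutative integral residuated lattice $(A,\wedge,\vee,\cdot,\to,0,1)$ satisfying $(a\to b)\vee(b\to a)=1$. Here: - integral means $1$ is the top element; - $a\cdot b\le c\iff b\le a\to c$; - the lattice reduct is distributive. Write $\neg a=a\to0$. An SBP-algebra is an MTL-algebra satisfying $\neg(a^2)\to(\neg\neg a\to a)=1$ and $(2a)^2=2(a^2)$, where $a^2=a\cdot a$ and $2a=\neg(\neg a\cdot\neg a)$. **Radical and Boolean skeleton.** - The radical is $\mathcal R(\mathbf A)=\{x\in A:\neg x<x\}$, the intersection of the maximal filters. - The Boolean skeleton is $\mathcal B(\mathbf A)=\{u\in A:u\vee\neg u=1\}$, a Boolean algebra. - $\delta:\mathcal R(\mathbf A)\to\mathcal R(\mathbf A)$ is $\delta(x)=\neg\neg x$. - The image $\delta[\mathcal R(\mathbf A)]$ is a lattice with top $1$. **Filters.** - A prime filter is a proper lattice filter $F$ with $a\vee b\in F\Rightarrow a\in F$ or $b\in F$. - $\mathcal S(\mathbf A)$ is the set of prime filters of $\mathbf A$ and $\mathcal S(\mathcal B(\mathbf A))$ is the set of ultrafilters of $\mathcal B(\mathbf A)$. - For a lattice $L$ with top, $\mathcal S(L)$ is the set of generalized prime filters, i.e. prime filters of $L$ together with $L$ itself. This applies in particular to $L=\mathcal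 R(\mathbf A)$ and $L=\delta[\mathcal R(\mathbf A)]$. **The sets $\mathcal F_{\mathbf A}$, $\mathcal F_{\mathbf A}^\partial$ and $\mathcal F_{\mathbf A}^{\bowtie}$.** - $\mathcal F_{\mathbf A}$ is the set of pairs $(\mathfrak u,\mathfrak x)\in\mathcal S(\mathcal B(\mathbf A))\times\mathcal S(\mathcal R(\mathbf A))$ such that for all $u\in\mathcal B(\mathbf A)$ and $x\in\mathcal R(\mathbf A)$: $u\vee x\in\mathfrak x$ implies $u\in\mathfrak u$ or $x\in\mathfrak x$. - $\mathcal F_{\mathbf A}^\partial$ is the set of formal elements $+(\mathfrak u,\mathfrak y)$ with $(\mathfrak u,\mathfrak y)\in\mathcal S(\mathcal B(\mathbf A))\times\mathcal S(\delta[\mathcal R(\mathbf A)])$, $(\mathfrak u,\delta^{ -1}[\mathfrak y])\in\mathcal F_{\mathbf A}$ and $\delta^{ -1}[\mathfrak y]\ne\mathcal R(\mathbf A)$. - $\mathcal F_{\mathbf A}^{\bowtie}$ is the disjoint union of $\mathcal F_{\mathbf A}$ and $\mathcal F_{\mathbf A}^\partial$. The order $\sqsubseteq$ on $\mathcal F_{\mathbf A}^{\bowtie}$ is defined by: - $(\mathfrak u,\mathfrak x)\sqsubseteq(\mathfrak v,\mathfrak y)$ iff $\mathfrak u=\mathfrak v$ and $\mathfrak x\subseteq\mathfrak y$; - $+(\mathfrak u,\mathfrak x)\sqsubseteq+(\mathfrak v,\mathfrak y)$ iff $\mathfrak u=\mathfrak v$ and $\mathfrak y\subseteq\mathfrak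 x$; - $(\mathfrak u,\mathfrak x)\sqsubseteq+(\mathfrak v,\mathfrak y)$ iff $\mathfrak u=\mathfrak v$; - no other relations hold. -}

module Defs where

open import Level using (0ℓ)
open import Data.Empty using (⊥)
open import Data.Unit using (⊤)
open import Data.Product using (Σ; ∃; _×_; _,_; proj₁; proj₂)
open import Data.Sum using (_⊎_)
open import Relation.Nullary using (¬_)
open import Relation.Binary.PropositionalEquality using (_≡_; _≢_)
import Algebra.Structures as AS
import Algebra.Lattice.Structures as LS

record MTLAlgebra : Set₁ where
  infixr 6 _∧_ _∨_
  infixr 7 _·_
  infixr 5 _⇒_
  infix 4 _≤_ _<_
  field
    Carrier : Set
    _∧_ _∨_ _·_ _⇒_ : Carrier → Carrier → Carrier
    𝟎 𝟏 : Carrier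
    isDistributiveLattice : LS.IsDistributiveLattice {A = Carrier} _≡_ _∨_ _∧_
    ·-isCommutativeMonoid : AS.IsCommutativeMonoid {A = Carrier} _≡_ _·_ 𝟏

  _≤_ : Carrier → Carrier → Set
  a ≤ b = a ∧ b ≡ a

  field
    𝟎-bot : ∀ a → 𝟎 ≤ a
    𝟏-top : ∀ a → a ≤ 𝟏
    residuated : ∀ a b c → (a · b ≤ c → b ≤ (a ⇒ c)) × (b ≤ (a ⇒ c) → a · b ≤ c)
    prelinear : ∀ a b → (a ⇒ b) ∨ (b ⇒ a) ≡ 𝟏

  ∼_ : Carrier → Carrier
  ∼ a = a ⇒ 𝟎

  _² : Carrier → Carrier
  a ² = a · a

  2×_ : Carrier → Carrier
  2× a = ∼ ((∼ a) · (∼ a))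

  _<_ : Carrier → Carrier → Set
  a < b = a ≤ b × a ≢ b

record SBPAlgebra : Set₁ where
  field
    mtl : MTLAlgebra
  open MTLAlgebra mtl
  field
    sbp₁ : ∀ a → (∼ (a ²)) ⇒ ((∼ (∼ a)) ⇒ a) ≡ 𝟏
    sbp₂ : ∀ a → (2× a) ² ≡ 2× (a ²)

Pred : Set → Set₁
Pred X = X → Set

_⊆_ : {X : Set} → Pred X → Pred X → Set
P ⊆ Q = ∀ x → P x → Q x

_≐_ : {X : Set} → Pred X → Pred X → Set
P ≐ Q = (P ⊆ Q) × (Q ⊆ P)

-- Order isomorphism between preorders whose underlying posets are
-- obtained by identifying mutually related elements.

record OrderIso {P Q : Set₁} (_≤P_ : P → P → Set) (_≤Q_ : Q → Q → Set) : Set₁ where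
  field
    to         : P → Q
    preserves  : ∀ x y → x ≤P y → to x ≤Q to y
    reflects   : ∀ x y → to x ≤Q to y → x ≤P y
    surjective : ∀ q → Σ P λ p → (to p ≤Q q) × (q ≤Q to p)

module SBPNotions (𝐀 : SBPAlgebra) where
  open SBPAlgebra 𝐀
  open MTLAlgebra mtl public

  InRad : Pred Carrier
  InRad x = (∼ x) < x

  InBool : Pred Carrier
  InBool u = u ∨ (∼ u) ≡ 𝟏

  δ : Carrier → Carrier
  δ x = ∼ (∼ x)

  InδRad : Pred Carrier
  InδRad y = Σ Carrier λ x → InRad x × δ x ≡ y

  -- F is a lattice filter of the sublattice S (with top 𝟏) which is
  -- prime in the generalized sense (the whole S is allowed)
  record IsGenPrimeFilter (S F : Pred Carrier) : Set where
    field
      sub   : F ⊆ S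
      top   : F 𝟏
      up    : ∀ a b → F a → S b → a ≤ b → F b
      meet  : ∀ a b → F a → F b → F (a ∧ b)
      prime : ∀ a b → S a → S b → F (a ∨ b) → F a ⊎ F b

  GenPrimeFilter : Pred Carrier → Set₁
  GenPrimeFilter S = Σ (Pred Carrier) (IsGenPrimeFilter S)

  IsPrimeFilter : Pred Carrier → Pred Carrier → Set
  IsPrimeFilter S F = IsGenPrimeFilter S F × (Σ Carrier λ a → S a × ¬ F a)

  PrimeFilterA : Set₁
  PrimeFilterA = Σ (Pred Carrier) (IsPrimeFilter (λ _ → ⊤))

  -- S(B(A)): ultrafilters (= proper prime filters) of the Boolean algebra B(A)
  UltrafilterB : Set₁
  UltrafilterB = Σ (Pred Carrier) (IsPrimeFilter InBool)

  Compatible : Pred Carrier → Pred Carrier → Set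
  Compatible 𝔲 𝔵 = ∀ u x → InBool u → InRad x → 𝔵 (u ∨ x) → 𝔲 u ⊎ 𝔵 x

  F-A : Set₁
  F-A = Σ UltrafilterB λ 𝔲 → Σ (GenPrimeFilter InRad) λ 𝔵 →
          Compatible (proj₁ 𝔲) (proj₁ 𝔵)

  δ⁻¹ : Pred Carrier → Pred Carrier
  δ⁻¹ 𝔶 x = InRad x × 𝔶 (δ x)

  F-A∂ : Set₁
  F-A∂ = Σ UltrafilterB λ 𝔲 → Σ (GenPrimeFilter InδRad) λ 𝔶 →
           IsGenPrimeFilter InRad (δ⁻¹ (proj₁ 𝔶))
         × Compatible (proj₁ 𝔲) (δ⁻¹ (proj₁ 𝔶))
         × ¬ (InRad ≐ δ⁻¹ (proj₁ 𝔶))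

  data F⋈ : Set₁ where
    ⟨_⟩ : F-A → F⋈
    +⟨_⟩ : F-A∂ → F⋈

  _⊑_ : F⋈ → F⋈ → Set
  ⟨ p ⟩ ⊑ ⟨ q ⟩ = (proj₁ (proj₁ p) ≐ proj₁ (proj₁ q))
                × (proj₁ (proj₁ (proj₂ p)) ⊆ proj₁ (proj₁ (proj₂ q)))
  +⟨ p ⟩ ⊑ +⟨ q ⟩ = (proj₁ (proj₁ p) ≐ proj₁ (proj₁ q))
                × (proj₁ (proj₁ (proj₂ q)) ⊆ proj₁ (proj₁ (proj₂ p)))
  ⟨ p ⟩ ⊑ +⟨ q ⟩ = proj₁ (proj₁ p) ≐ proj₁ (proj₁ q)
  +⟨ p ⟩ ⊑ ⟨ q ⟩ = ⊥

  _⊆ₚ_ : PrimeFilterA → PrimeFilterA → Set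
  F ⊆ₚ G = proj₁ F ⊆ proj₁ G

-- In an SBP-algebra every element a is glued from radical pieces along the Boolean element
-- β a = (2a)²: both a ⁺ = a ∨ ∼ β a and a ⁻ = ∼ a ∨ β a are radical, β a ∧ a ⁺ ≤ a and
-- ∼ (a ⁻) ≤ a. Hence a prime filter F is determined by the ultrafilter F ∩ B(A) together with
-- F ∩ R(A) when F contains no negation of a radical element, and otherwise (then R(A) ⊆ F) with
-- the set of y ∈ δ[R(A)] such that ∼ y ∉ F. Conversely (𝔲, 𝔵) generates the prime filter of all
-- a above some u ∧ x with u ∈ 𝔲, x ∈ 𝔵, and +(𝔲, 𝔶) the one generated by 𝔲 and the negations of
-- the radical elements outside δ⁻¹[𝔶]. Properness rests on the SBP fact that a Boolean e with
-- e ∧ x ≤ ∼ s for radical x and s is 𝟎. Excluded middle decides to which of the two kinds a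
-- prime filter belongs, and drives the primeness arguments.
module Submission where

open import Defs
open import Level using (0ℓ)
open import Axiom.ExcludedMiddle using (ExcludedMiddle)
open import Data.Empty using (⊥; ⊥-elim)
open import Data.Unit using (⊤; tt)
open import Data.Product using (Σ; _×_; _,_; proj₁; proj₂; swap)
open import Data.Sum using (_⊎_; inj₁; inj₂; [_,_])
import Data.Sum as Sum
open import Relation.Nullary using (¬_; Dec; yes; no)
open import Relation.Binary.PropositionalEquality
  using (_≡_; _≢_; refl; sym; trans; cong; cong₂; subst)
open import Algebra.Lattice.Bundles using (Lattice)
import Algebra.Structures as AS
import Algebra.Lattice.Structures as LS
import Algebra.Lattice.Properties.Lattice as LatticeProperties
import Relation.Binary.Lattice as OrderTheoretic
import Relation.Binary.Lattice.Properties.MeetSemilattice as MeetSemilatticeProperties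
import Relation.Binary.Lattice.Properties.JoinSemilattice as JoinSemilatticeProperties
import Relation.Binary.Reasoning.PartialOrder as ≤-Reasoning

module MTLProperties (𝐀 : MTLAlgebra) where
  open MTLAlgebra 𝐀 hiding (_≤_)
  open LS.IsDistributiveLattice isDistributiveLattice public
    using (∧-comm; ∨-comm; ∧-distribˡ-∨; ∧-distribʳ-∨; ∨-distribʳ-∧)
  open AS.IsCommutativeMonoid ·-isCommutativeMonoid public
    using ()
    renaming (assoc to ·-assoc; comm to ·-comm; identityˡ to ·-identityˡ; identityʳ to ·-identityʳ)

  lattice : Lattice 0ℓ 0ℓ
  lattice = record { isLattice = LS.IsDistributiveLattice.isLattice isDistributiveLattice }

  open LatticeProperties lattice public using (poset; ∧-idem)
  open OrderTheoretic.Lattice (LatticeProperties.∨-∧-orderTheoreticLattice lattice) public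
    using (_≤_; x∧y≤x; x∧y≤y; ∧-greatest; x≤x∨y; y≤x∨y; ∨-least; meetSemilattice; joinSemilattice)
    renaming (refl to ≤-refl; trans to ≤-trans; antisym to ≤-antisym; reflexive to ≤-reflexive)
  open MeetSemilatticeProperties meetSemilattice public using (∧-monotonic)
  open JoinSemilatticeProperties joinSemilattice public using (∨-monotonic)
  open ≤-Reasoning poset

  -- The library orders the lattice by a ≡ a ∧ b, Defs by a ∧ b ≡ a;
  -- hence the `sym`s at the interface with Defs.
  𝟎-least : ∀ a → 𝟎 ≤ a
  𝟎-least a = sym (MTLAlgebra.𝟎-bot 𝐀 a)

  𝟏-greatest : ∀ a → a ≤ 𝟏
  𝟏-greatest a = sym (MTLAlgebra.𝟏-top 𝐀 a)

  transpose-⇒ : ∀ {a b c} → a · b ≤ c → b ≤ a ⇒ c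
  transpose-⇒ {a} {b} {c} p = sym (proj₁ (residuated a b c) (sym p))

  transpose-· : ∀ {a b c} → b ≤ a ⇒ c → a · b ≤ c
  transpose-· {a} {b} {c} p = sym (proj₂ (residuated a b c) (sym p))

  𝟏≤⇒≡𝟏 : ∀ {a} → 𝟏 ≤ a → a ≡ 𝟏
  𝟏≤⇒≡𝟏 p = ≤-antisym (𝟏-greatest _) p

  ≤𝟎⇒≡𝟎 : ∀ {a} → a ≤ 𝟎 → a ≡ 𝟎
  ≤𝟎⇒≡𝟎 p = ≤-antisym p (𝟎-least _)

  ≡𝟏-up : ∀ {a b} → a ≤ b → a ≡ 𝟏 → b ≡ 𝟏
  ≡𝟏-up p refl = 𝟏≤⇒≡𝟏 p

  𝟎≡𝟏⇒≡𝟏 : 𝟎 ≡ 𝟏 → ∀ a → a ≡ 𝟏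
  𝟎≡𝟏⇒≡𝟏 𝟎≡𝟏 a = 𝟏≤⇒≡𝟏 (subst (_≤ a) 𝟎≡𝟏 (𝟎-least a))

  ∧-≡𝟏 : ∀ {a b} → a ≡ 𝟏 → b ≡ 𝟏 → a ∧ b ≡ 𝟏
  ∧-≡𝟏 refl refl = 𝟏≤⇒≡𝟏 (∧-greatest ≤-refl ≤-refl)

  ∧-swap-≤ : ∀ a b c → (a ∧ b) ∧ c ≤ (a ∧ c) ∧ b
  ∧-swap-≤ a b c = ∧-greatest (∧-monotonic (x∧y≤x a b) ≤-refl) (≤-trans (x∧y≤x _ c) (x∧y≤y a b))

  ⇒-eval : ∀ a b → a · (a ⇒ b) ≤ b
  ⇒-eval a b = transpose-· ≤-refl

  ·-monoʳ-≤ : ∀ {a b c} → b ≤ c → a · b ≤ a · c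
  ·-monoʳ-≤ p = transpose-· (≤-trans p (transpose-⇒ ≤-refl))

  ·-monoˡ-≤ : ∀ {a b c} → b ≤ c → b · a ≤ c · a
  ·-monoˡ-≤ {a} {b} {c} p = begin
    b · a ≡⟨ ·-comm b a ⟩
    a · b ≤⟨ ·-monoʳ-≤ p ⟩
    a · c ≡⟨ ·-comm a c ⟩
    c · a ∎

  ·-mono-≤ : ∀ {a b c d} → a ≤ b → c ≤ d → a · c ≤ b · d
  ·-mono-≤ p q = ≤-trans (·-monoˡ-≤ p) (·-monoʳ-≤ q)

  x·y≤x : ∀ a b → a · b ≤ a
  x·y≤x a b = begin
    a · b ≤⟨ ·-monoʳ-≤ (𝟏-greatest b) ⟩
    a · 𝟏 ≡⟨ ·-identityʳ a ⟩
    a     ∎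

  x·y≤y : ∀ a b → a · b ≤ b
  x·y≤y a b = begin
    a · b ≤⟨ ·-monoˡ-≤ (𝟏-greatest a) ⟩
    𝟏 · b ≡⟨ ·-identityˡ b ⟩
    b     ∎

  ·-distribˡ-∨ : ∀ a b c → a · (b ∨ c) ≡ a · b ∨ a · c
  ·-distribˡ-∨ a b c = ≤-antisym
    (transpose-· (∨-least (transpose-⇒ (x≤x∨y _ _)) (transpose-⇒ (y≤x∨y _ _))))
    (∨-least (·-monoʳ-≤ (x≤x∨y b c)) (·-monoʳ-≤ (y≤x∨y b c)))

  ≤-by-cover : ∀ {p q t c} → p ∨ q ≡ 𝟏 → t · p ≤ c → t · q ≤ c → t ≤ c
  ≤-by-cover {p} {q} {t} {c} cover tp≤c tq≤c = begin
    t             ≡⟨ sym (·-identityʳ t) ⟩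
    t · 𝟏         ≡⟨ cong (t ·_) (sym cover) ⟩
    t · (p ∨ q)   ≡⟨ ·-distribˡ-∨ t p q ⟩
    t · p ∨ t · q ≤⟨ ∨-least tp≤c tq≤c ⟩
    c             ∎

  ∨-cover-squareʳ : ∀ {a b} → a ∨ b ≡ 𝟏 → a ∨ b · b ≡ 𝟏
  ∨-cover-squareʳ {a} {b} cover = ≡𝟏-up (∨-least (x≤x∨y a _) b≤a∨b²) cover
    where
    b≤a∨b² : b ≤ a ∨ b · b
    b≤a∨b² = ≤-by-cover cover (≤-trans (x·y≤y b a) (x≤x∨y a _)) (y≤x∨y a _)

  ∨-squares-cover : ∀ {a b} → a ∨ b ≡ 𝟏 → a · a ∨ b · b ≡ 𝟏
  ∨-squares-cover {a} {b} cover =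
    trans (∨-comm _ _) (∨-cover-squareʳ (trans (∨-comm _ _) (∨-cover-squareʳ cover)))

  x·∼x≡𝟎 : ∀ a → a · ∼ a ≡ 𝟎
  x·∼x≡𝟎 a = ≤𝟎⇒≡𝟎 (⇒-eval a 𝟎)

  ∼x·x≡𝟎 : ∀ a → ∼ a · a ≡ 𝟎
  ∼x·x≡𝟎 a = trans (·-comm (∼ a) a) (x·∼x≡𝟎 a)

  ·≤𝟎⇒≤∼ : ∀ {a b} → b · a ≤ 𝟎 → b ≤ ∼ a
  ·≤𝟎⇒≤∼ {a} {b} p = transpose-⇒ (≤-trans (≤-reflexive (·-comm a b)) p)

  ≤∼⇒·≤𝟎 : ∀ {a b} → b ≤ ∼ a → b · a ≤ 𝟎
  ≤∼⇒·≤𝟎 {a} {b} p = ≤-trans (≤-reflexive (·-comm b a)) (transpose-· p)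

  x≤∼∼x : ∀ a → a ≤ ∼ ∼ a
  x≤∼∼x a = ·≤𝟎⇒≤∼ (≤-reflexive (x·∼x≡𝟎 a))

  ∼-antitone : ∀ {a b} → a ≤ b → ∼ b ≤ ∼ a
  ∼-antitone {a} {b} p = ·≤𝟎⇒≤∼ (≤-trans (·-monoʳ-≤ p) (≤-reflexive (∼x·x≡𝟎 b)))

  ∼∼∼x≡∼x : ∀ a → ∼ ∼ ∼ a ≡ ∼ a
  ∼∼∼x≡∼x a = ≤-antisym (∼-antitone (x≤∼∼x a)) (x≤∼∼x (∼ a))

  ∼𝟎≡𝟏 : ∼ 𝟎 ≡ 𝟏
  ∼𝟎≡𝟏 = 𝟏≤⇒≡𝟏 (transpose-⇒ (x·y≤x 𝟎 𝟏))

  ∼𝟏≡𝟎 : ∼ 𝟏 ≡ 𝟎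
  ∼𝟏≡𝟎 = ≤𝟎⇒≡𝟎 (≤-trans (≤-reflexive (sym (·-identityˡ (∼ 𝟏)))) (⇒-eval 𝟏 𝟎))

  ∼∼𝟏≡𝟏 : ∼ ∼ 𝟏 ≡ 𝟏
  ∼∼𝟏≡𝟏 = trans (cong ∼_ ∼𝟏≡𝟎) ∼𝟎≡𝟏

  ∼≡𝟏⇒≡𝟎 : ∀ {a} → ∼ a ≡ 𝟏 → a ≡ 𝟎
  ∼≡𝟏⇒≡𝟎 {a} ∼a≡𝟏 = ≤𝟎⇒≡𝟎 (begin
    a     ≤⟨ x≤∼∼x a ⟩
    ∼ ∼ a ≡⟨ cong ∼_ ∼a≡𝟏 ⟩
    ∼ 𝟏   ≡⟨ ∼𝟏≡𝟎 ⟩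
    𝟎     ∎)

  deMorgan₂ : ∀ a b → ∼ (a ∨ b) ≡ ∼ a ∧ ∼ b
  deMorgan₂ a b = ≤-antisym
    (∧-greatest (∼-antitone (x≤x∨y a b)) (∼-antitone (y≤x∨y a b)))
    (·≤𝟎⇒≤∼ (begin
      (∼ a ∧ ∼ b) · (a ∨ b)             ≡⟨ ·-distribˡ-∨ _ a b ⟩
      (∼ a ∧ ∼ b) · a ∨ (∼ a ∧ ∼ b) · b ≤⟨ ∨-least (vanish (x∧y≤x _ _)) (vanish (x∧y≤y _ _)) ⟩
      𝟎                                 ∎))
    where
    vanish : ∀ {c d} → c ≤ ∼ d → c · d ≤ 𝟎
    vanish {c} {d} c≤∼d = ≤-trans (·-monoˡ-≤ c≤∼d) (≤-reflexive (∼x·x≡𝟎 d))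

  deMorgan₁ : ∀ a b → ∼ (a ∧ b) ≡ ∼ a ∨ ∼ b
  deMorgan₁ a b = ≤-antisym
    (≤-by-cover (prelinear a b)
      (≤-trans (∼∧·⇒≤∼ a b) (x≤x∨y _ _))
      (≤-trans (subst (λ c → ∼ c · (b ⇒ a) ≤ ∼ b) (∧-comm b a) (∼∧·⇒≤∼ b a)) (y≤x∨y _ _)))
    (∨-least (∼-antitone (x∧y≤x a b)) (∼-antitone (x∧y≤y a b)))
    where
    ∼∧·⇒≤∼ : ∀ a b → ∼ (a ∧ b) · (a ⇒ b) ≤ ∼ a
    ∼∧·⇒≤∼ a b = ·≤𝟎⇒≤∼ (begin
      (∼ (a ∧ b) · (a ⇒ b)) · a ≡⟨ ·-assoc _ _ a ⟩
      ∼ (a ∧ b) · ((a ⇒ b) · a) ≡⟨ cong (∼ (a ∧ b) ·_) (·-comm _ a) ⟩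
      ∼ (a ∧ b) · (a · (a ⇒ b)) ≤⟨ ·-monoʳ-≤ (∧-greatest (x·y≤x a _) (⇒-eval a b)) ⟩
      ∼ (a ∧ b) · (a ∧ b)       ≡⟨ ∼x·x≡𝟎 _ ⟩
      𝟎                         ∎)

  ∼∼-monotone : ∀ {a b} → a ≤ b → ∼ ∼ a ≤ ∼ ∼ b
  ∼∼-monotone a≤b = ∼-antitone (∼-antitone a≤b)

  ∼∼-∨ : ∀ a b → ∼ ∼ (a ∨ b) ≡ ∼ ∼ a ∨ ∼ ∼ b
  ∼∼-∨ a b = trans (cong ∼_ (deMorgan₂ a b)) (deMorgan₁ (∼ a) (∼ b))

  ∼∼-∧ : ∀ a b → ∼ ∼ (a ∧ b) ≡ ∼ ∼ a ∧ ∼ ∼ b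
  ∼∼-∧ a b = trans (cong ∼_ (deMorgan₁ a b)) (deMorgan₂ (∼ a) (∼ b))

  boolean-∧≡· : ∀ {e} t → e ∨ ∼ e ≡ 𝟏 → e ∧ t ≡ e · t
  boolean-∧≡· {e} t bool = ≤-antisym
    (≤-by-cover bool
      (≤-trans (·-monoˡ-≤ (x∧y≤y e t)) (≤-reflexive (·-comm t e)))
      (≤-trans (·-monoˡ-≤ (x∧y≤x e t)) (≤-trans (≤-reflexive (x·∼x≡𝟎 e)) (𝟎-least _))))
    (∧-greatest (x·y≤x e t) (x·y≤y e t))

  boolean-∧∼≡𝟎 : ∀ {e} → e ∨ ∼ e ≡ 𝟏 → e ∧ ∼ e ≡ 𝟎
  boolean-∧∼≡𝟎 {e} bool = trans (boolean-∧≡· (∼ e) bool) (x·∼x≡𝟎 e)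

  boolean-·-idem : ∀ {e} → e ∨ ∼ e ≡ 𝟏 → e · e ≡ e
  boolean-·-idem {e} bool = trans (sym (boolean-∧≡· e bool)) (∧-idem e)

  boolean-∼∼ : ∀ {e} → e ∨ ∼ e ≡ 𝟏 → ∼ ∼ e ≡ e
  boolean-∼∼ {e} bool = ≤-antisym
    (≤-by-cover bool (x·y≤y _ e) (≤-trans (≤-reflexive (∼x·x≡𝟎 (∼ e))) (𝟎-least e)))
    (x≤∼∼x e)

  boolean-∼ : ∀ {e} → e ∨ ∼ e ≡ 𝟏 → ∼ e ∨ ∼ ∼ e ≡ 𝟏
  boolean-∼ {e} bool = ≡𝟏-up (∨-monotonic ≤-refl (x≤∼∼x e)) (trans (∨-comm (∼ e) e) bool)

  boolean-∧ : ∀ {a b} → a ∨ ∼ a ≡ 𝟏 → b ∨ ∼ b ≡ 𝟏 → (a ∧ b) ∨ ∼ (a ∧ b) ≡ 𝟏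
  boolean-∧ {a} {b} bool-a bool-b = begin-equality
    (a ∧ b) ∨ ∼ (a ∧ b)                   ≡⟨ cong ((a ∧ b) ∨_) (deMorgan₁ a b) ⟩
    (a ∧ b) ∨ (∼ a ∨ ∼ b)                 ≡⟨ ∨-distribʳ-∧ _ a b ⟩
    (a ∨ (∼ a ∨ ∼ b)) ∧ (b ∨ (∼ a ∨ ∼ b)) ≡⟨ ∧-≡𝟏 (≡𝟏-up (∨-monotonic ≤-refl (x≤x∨y _ _)) bool-a)
                                                  (≡𝟏-up (∨-monotonic ≤-refl (y≤x∨y _ _)) bool-b) ⟩
    𝟏                                     ∎

  boolean-𝟏 : 𝟏 ∨ ∼ 𝟏 ≡ 𝟏
  boolean-𝟏 = 𝟏≤⇒≡𝟏 (x≤x∨y 𝟏 _)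

  boolean-𝟎 : 𝟎 ∨ ∼ 𝟎 ≡ 𝟏
  boolean-𝟎 = ≡𝟏-up (y≤x∨y 𝟎 _) ∼𝟎≡𝟏

  boolean-shunt : ∀ {e x c} → e ∨ ∼ e ≡ 𝟏 → e ∧ x ≤ c → x ≤ ∼ e ∨ c
  boolean-shunt {e} {x} {c} bool e∧x≤c = ≤-by-cover bool
    (begin
      x · e   ≡⟨ ·-comm x e ⟩
      e · x   ≡⟨ sym (boolean-∧≡· x bool) ⟩
      e ∧ x   ≤⟨ e∧x≤c ⟩
      c       ≤⟨ y≤x∨y _ c ⟩
      ∼ e ∨ c ∎)
    (≤-trans (x·y≤y x (∼ e)) (x≤x∨y _ c))

  AboveNeg : Carrier → Set
  AboveNeg x = ∼ x ≤ x

  aboveNeg-∼≤ : ∀ {x z} → AboveNeg x → AboveNeg z → ∼ x ≤ z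
  aboveNeg-∼≤ {x} {z} above-x above-z = ≤-by-cover (prelinear x z)
    (≤-trans (·-monoˡ-≤ above-x) (⇒-eval x z))
    (≤-trans (·≤𝟎⇒≤∼ (begin
       (∼ x · (z ⇒ x)) · z ≡⟨ ·-assoc (∼ x) (z ⇒ x) z ⟩
       ∼ x · ((z ⇒ x) · z) ≡⟨ cong (∼ x ·_) (·-comm _ z) ⟩
       ∼ x · (z · (z ⇒ x)) ≤⟨ ·-monoʳ-≤ (⇒-eval z x) ⟩
       ∼ x · x             ≡⟨ ∼x·x≡𝟎 x ⟩
       𝟎                   ∎)) above-z)

  aboveNeg-∧ : ∀ {x z} → AboveNeg x → AboveNeg z → AboveNeg (x ∧ z)
  aboveNeg-∧ {x} {z} above-x above-z = begin
    ∼ (x ∧ z) ≡⟨ deMorgan₁ x z ⟩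
    ∼ x ∨ ∼ z ≤⟨ ∨-least (∧-greatest above-x (aboveNeg-∼≤ above-x above-z))
                         (∧-greatest (aboveNeg-∼≤ above-z above-x) above-z) ⟩
    x ∧ z     ∎

  aboveNeg-up : ∀ {x y} → x ≤ y → AboveNeg x → AboveNeg y
  aboveNeg-up x≤y above-x = ≤-trans (∼-antitone x≤y) (≤-trans above-x x≤y)

  aboveNeg-𝟏 : AboveNeg 𝟏
  aboveNeg-𝟏 = 𝟏-greatest _

module SBPProperties (𝐀 : SBPAlgebra) where
  open SBPAlgebra 𝐀 using (mtl; sbp₁; sbp₂)
  open SBPNotions 𝐀 hiding (_≤_)
  open MTLProperties mtl public
  open ≤-Reasoning poset

  β : Carrier → Carrier
  β a = (2× a) ²

  module _ (a : Carrier) where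
    private
      e e′ : Carrier
      e = a ⇒ ∼ a
      e′ = ∼ a ⇒ a

      e²∨e′²≡𝟏 : e · e ∨ e′ · e′ ≡ 𝟏
      e²∨e′²≡𝟏 = ∨-squares-cover (prelinear a (∼ a))

      e·a≤∼a : e · a ≤ ∼ a
      e·a≤∼a = ≤-trans (≤-reflexive (·-comm e a)) (⇒-eval a (∼ a))

      e≤∼a² : e ≤ ∼ (a ²)
      e≤∼a² = ·≤𝟎⇒≤∼ (begin
        e · (a · a) ≡⟨ ·-assoc e a a ⟨
        (e · a) · a ≤⟨ ·-monoˡ-≤ e·a≤∼a ⟩
        ∼ a · a     ≡⟨ ∼x·x≡𝟎 a ⟩
        𝟎           ∎)

      e′≤2a : e′ ≤ 2× a
      e′≤2a = ·≤𝟎⇒≤∼ (begin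
        e′ · (∼ a · ∼ a) ≡⟨ ·-assoc e′ (∼ a) (∼ a) ⟨
        (e′ · ∼ a) · ∼ a ≤⟨ ·-monoˡ-≤ (≤-trans (≤-reflexive (·-comm e′ (∼ a))) (⇒-eval (∼ a) a)) ⟩
        a · ∼ a          ≡⟨ x·∼x≡𝟎 a ⟩
        𝟎                ∎)

      e′²≤β : e′ · e′ ≤ β a
      e′²≤β = ·-mono-≤ e′≤2a e′≤2a

      -- sbp₂ turns β a into 2× (a ²) = ∼ (c · c) with c = ∼ (a ²).
      e²≤∼β : e · e ≤ ∼ β a
      e²≤∼β = ·≤𝟎⇒≤∼ (begin
        (e · e) · β a                  ≤⟨ ·-monoˡ-≤ (·-mono-≤ e≤∼a² e≤∼a²) ⟩
        (∼ (a ²) · ∼ (a ²)) · β a      ≡⟨ cong ((∼ (a ²) · ∼ (a ²)) ·_) (sbp₂ a) ⟩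
        (∼ (a ²) · ∼ (a ²)) · 2× (a ²) ≡⟨ x·∼x≡𝟎 _ ⟩
        𝟎                              ∎)

      ∼β·t·e′²≤𝟎 : ∀ t → (∼ β a · t) · (e′ · e′) ≤ 𝟎
      ∼β·t·e′²≤𝟎 t = ≤-trans (·-mono-≤ (x·y≤x _ t) e′²≤β) (≤-reflexive (∼x·x≡𝟎 (β a)))

      ∼β·∼∼a·e²≤∼∼a·e : (∼ β a · ∼ ∼ a) · (e · e) ≤ ∼ ∼ a · e
      ∼β·∼∼a·e²≤∼∼a·e = ·-mono-≤ (x·y≤y _ _) (x·y≤x e e)

      ∼a²·∼∼a≤a : ∼ (a ²) · ∼ ∼ a ≤ a
      ∼a²·∼∼a≤a = begin
        ∼ (a ²) · ∼ ∼ a ≡⟨ ·-comm _ _ ⟩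
        ∼ ∼ a · ∼ (a ²) ≤⟨ transpose-· ∼a²≤∼∼a⇒a ⟩
        a               ∎
        where
        ∼a²≤∼∼a⇒a : ∼ (a ²) ≤ ∼ ∼ a ⇒ a
        ∼a²≤∼∼a⇒a = ≤-trans (≤-reflexive (sym (·-identityʳ _))) (transpose-· (≤-reflexive (sym (sbp₁ a))))

    β-boolean : β a ∨ ∼ β a ≡ 𝟏
    β-boolean = ≡𝟏-up (≤-trans (∨-monotonic e²≤∼β e′²≤β) (≤-reflexive (∨-comm _ _))) e²∨e′²≡𝟏

    β·∼x≤x : β a · ∼ a ≤ a
    β·∼x≤x = ≤-by-cover e²∨e′²≡𝟏
      (begin
        (β a · ∼ a) · (e · e) ≤⟨ ·-monoˡ-≤ (x·y≤x _ _) ⟩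
        β a · (e · e)         ≤⟨ ≤-trans (≤-reflexive (·-comm _ _)) (≤∼⇒·≤𝟎 e²≤∼β) ⟩
        𝟎                     ≤⟨ 𝟎-least a ⟩
        a                     ∎)
      (begin
        (β a · ∼ a) · (e′ · e′) ≤⟨ ·-mono-≤ (x·y≤y _ _) (x·y≤x _ _) ⟩
        ∼ a · e′                ≤⟨ ⇒-eval (∼ a) a ⟩
        a                       ∎)

    ∼β·∼∼x≤∼x : ∼ β a · ∼ ∼ a ≤ ∼ a
    ∼β·∼∼x≤∼x = ≤-by-cover e²∨e′²≡𝟏
      (≤-trans ∼β·∼∼a·e²≤∼∼a·e (·≤𝟎⇒≤∼ (begin
        (∼ ∼ a · e) · a ≡⟨ ·-assoc _ e a ⟩
        ∼ ∼ a · (e · a) ≤⟨ ·-monoʳ-≤ e·a≤∼a ⟩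
        ∼ ∼ a · ∼ a     ≡⟨ ∼x·x≡𝟎 (∼ a) ⟩
        𝟎               ∎)))
      (≤-trans (∼β·t·e′²≤𝟎 _) (𝟎-least _))

    ∼β·∼∼x≤x : ∼ β a · ∼ ∼ a ≤ a
    ∼β·∼∼x≤x = ≤-by-cover e²∨e′²≡𝟏
      (begin
        (∼ β a · ∼ ∼ a) · (e · e) ≤⟨ ∼β·∼∼a·e²≤∼∼a·e ⟩
        ∼ ∼ a · e                 ≤⟨ ·-monoʳ-≤ e≤∼a² ⟩
        ∼ ∼ a · ∼ (a ²)           ≡⟨ ·-comm _ _ ⟩
        ∼ (a ²) · ∼ ∼ a           ≤⟨ ∼a²·∼∼a≤a ⟩
        a                         ∎)
      (≤-trans (∼β·t·e′²≤𝟎 _) (𝟎-least _))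

  infix 25 _⁺ _⁻
  _⁺ _⁻ : Carrier → Carrier
  a ⁺ = a ∨ ∼ β a
  a ⁻ = ∼ a ∨ β a

  ∼⁻≡∼β·∼∼x : ∀ a → ∼ (a ⁻) ≡ ∼ β a · ∼ ∼ a
  ∼⁻≡∼β·∼∼x a = begin-equality
    ∼ (∼ a ∨ β a)   ≡⟨ deMorgan₂ (∼ a) (β a) ⟩
    ∼ ∼ a ∧ ∼ β a   ≡⟨ ∧-comm _ _ ⟩
    ∼ β a ∧ ∼ ∼ a   ≡⟨ boolean-∧≡· _ (boolean-∼ (β-boolean a)) ⟩
    ∼ β a · ∼ ∼ a   ∎

  ⁺-aboveNeg : ∀ a → AboveNeg (a ⁺)
  ⁺-aboveNeg a = begin
    ∼ (a ∨ ∼ β a)   ≡⟨ deMorgan₂ a (∼ β a) ⟩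
    ∼ a ∧ ∼ ∼ β a   ≡⟨ cong (∼ a ∧_) (boolean-∼∼ (β-boolean a)) ⟩
    ∼ a ∧ β a       ≡⟨ ∧-comm _ _ ⟩
    β a ∧ ∼ a       ≡⟨ boolean-∧≡· _ (β-boolean a) ⟩
    β a · ∼ a       ≤⟨ β·∼x≤x a ⟩
    a               ≤⟨ x≤x∨y a _ ⟩
    a ⁺             ∎

  ⁻-aboveNeg : ∀ a → AboveNeg (a ⁻)
  ⁻-aboveNeg a = begin
    ∼ (a ⁻)         ≡⟨ ∼⁻≡∼β·∼∼x a ⟩
    ∼ β a · ∼ ∼ a   ≤⟨ ∼β·∼∼x≤∼x a ⟩
    ∼ a             ≤⟨ x≤x∨y (∼ a) _ ⟩
    a ⁻             ∎

  β∧⁺≤x : ∀ a → β a ∧ a ⁺ ≤ a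
  β∧⁺≤x a = begin
    β a ∧ (a ∨ ∼ β a)             ≡⟨ ∧-distribˡ-∨ (β a) a _ ⟩
    (β a ∧ a) ∨ (β a ∧ ∼ β a)     ≡⟨ cong ((β a ∧ a) ∨_) (boolean-∧∼≡𝟎 (β-boolean a)) ⟩
    (β a ∧ a) ∨ 𝟎                 ≤⟨ ∨-least (x∧y≤y _ a) (𝟎-least a) ⟩
    a                             ∎

  ∼⁻≤x : ∀ a → ∼ (a ⁻) ≤ a
  ∼⁻≤x a = ≤-trans (≤-reflexive (∼⁻≡∼β·∼∼x a)) (∼β·∼∼x≤x a)

  x∧∼β≤∼⁻ : ∀ a → a ∧ ∼ β a ≤ ∼ (a ⁻)
  x∧∼β≤∼⁻ a = begin
    a ∧ ∼ β a       ≡⟨ ∧-comm a _ ⟩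
    ∼ β a ∧ a       ≤⟨ ∧-monotonic ≤-refl (x≤∼∼x a) ⟩
    ∼ β a ∧ ∼ ∼ a   ≡⟨ ∧-comm _ _ ⟩
    ∼ ∼ a ∧ ∼ β a   ≡⟨ deMorgan₂ (∼ a) (β a) ⟨
    ∼ (a ⁻)         ∎

  ≤∨⇒∧∼β≤⁺ : ∀ {c a b} → c ≤ a ∨ b → c ∧ ∼ β b ≤ a ⁺
  ≤∨⇒∧∼β≤⁺ {c} {a} {b} c≤a∨b = begin
    c ∧ ∼ β b                   ≤⟨ ∧-monotonic c≤a∨b ≤-refl ⟩
    (a ∨ b) ∧ ∼ β b             ≡⟨ ∧-distribʳ-∨ _ a b ⟩
    (a ∧ ∼ β b) ∨ (b ∧ ∼ β b)   ≤⟨ ∨-monotonic (x∧y≤x a _) (x∧∼β≤∼⁻ b) ⟩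
    a ∨ ∼ (b ⁻)                 ≤⟨ ∨-least (x≤x∨y a _) (aboveNeg-∼≤ (⁻-aboveNeg b) (⁺-aboveNeg a)) ⟩
    a ⁺                         ∎

  ≤∨⇒∧∼β∧∼β≤∼[⁻∧⁻] : ∀ {c a b} → c ≤ a ∨ b → c ∧ (∼ β a ∧ ∼ β b) ≤ ∼ (a ⁻ ∧ b ⁻)
  ≤∨⇒∧∼β∧∼β≤∼[⁻∧⁻] {c} {a} {b} c≤a∨b = begin
    c ∧ (∼ β a ∧ ∼ β b)                       ≤⟨ ∧-monotonic c≤a∨b ≤-refl ⟩
    (a ∨ b) ∧ (∼ β a ∧ ∼ β b)                 ≡⟨ ∧-distribʳ-∨ _ a b ⟩
    (a ∧ (∼ β a ∧ ∼ β b)) ∨ (b ∧ (∼ β a ∧ ∼ β b))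
      ≤⟨ ∨-monotonic (∧-monotonic ≤-refl (x∧y≤x _ _)) (∧-monotonic ≤-refl (x∧y≤y _ _)) ⟩
    (a ∧ ∼ β a) ∨ (b ∧ ∼ β b)                 ≤⟨ ∨-monotonic (x∧∼β≤∼⁻ a) (x∧∼β≤∼⁻ b) ⟩
    ∼ (a ⁻) ∨ ∼ (b ⁻)                         ≡⟨ deMorgan₁ (a ⁻) (b ⁻) ⟨
    ∼ (a ⁻ ∧ b ⁻)                             ∎

  aboveNeg-∼²·∼²≡𝟎 : ∀ {x} → AboveNeg x → ∼ (x ²) · ∼ (x ²) ≡ 𝟎
  aboveNeg-∼²·∼²≡𝟎 {x} above-x = ∼≡𝟏⇒≡𝟎 (begin-equality
    ∼ (∼ (x ²) · ∼ (x ²)) ≡⟨ sbp₂ x ⟨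
    2× x · 2× x           ≡⟨ cong₂ _·_ 2x≡𝟏 2x≡𝟏 ⟩
    𝟏 · 𝟏                 ≡⟨ ·-identityˡ 𝟏 ⟩
    𝟏                     ∎)
    where
    2x≡𝟏 : 2× x ≡ 𝟏
    2x≡𝟏 = trans (cong ∼_ (≤𝟎⇒≡𝟎 (≤-trans (·-monoˡ-≤ above-x) (≤-reflexive (x·∼x≡𝟎 x))))) ∼𝟎≡𝟏

  ∼x≡x⇒𝟎≡𝟏 : ∀ {a} → ∼ a ≡ a → 𝟎 ≡ 𝟏
  ∼x≡x⇒𝟎≡𝟏 {a} ∼a≡a = begin-equality
    𝟎                   ≡⟨ ∼𝟏≡𝟎 ⟨
    ∼ 𝟏                 ≡⟨ cong ∼_ (·-identityˡ 𝟏) ⟨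
    ∼ (𝟏 · 𝟏)           ≡⟨ cong (λ t → ∼ (t · t)) (trans (cong ∼_ a²≡𝟎) ∼𝟎≡𝟏) ⟨
    2× (a ²)            ≡⟨ sbp₂ a ⟨
    2× a · 2× a         ≡⟨ cong (λ t → ∼ (t · t) · ∼ (t · t)) ∼a≡a ⟩
    ∼ (a ²) · ∼ (a ²)   ≡⟨ cong (λ t → ∼ t · ∼ t) a²≡𝟎 ⟩
    ∼ 𝟎 · ∼ 𝟎           ≡⟨ cong₂ _·_ ∼𝟎≡𝟏 ∼𝟎≡𝟏 ⟩
    𝟏 · 𝟏               ≡⟨ ·-identityˡ 𝟏 ⟩
    𝟏                   ∎
    where
    a²≡𝟎 : a · a ≡ 𝟎
    a²≡𝟎 = trans (cong (a ·_) (sym ∼a≡a)) (x·∼x≡𝟎 a)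

  rad⇒aboveNeg : ∀ {x} → InRad x → AboveNeg x
  rad⇒aboveNeg rad-x = sym (proj₁ rad-x)

  aboveNeg⇒rad : 𝟎 ≢ 𝟏 → ∀ {x} → AboveNeg x → InRad x
  aboveNeg⇒rad 𝟎≢𝟏 above-x = sym above-x , λ ∼x≡x → 𝟎≢𝟏 (∼x≡x⇒𝟎≡𝟏 ∼x≡x)

  rad⇒𝟎≢𝟏 : ∀ {x} → InRad x → 𝟎 ≢ 𝟏
  rad⇒𝟎≢𝟏 {x} rad-x 𝟎≡𝟏 = proj₂ rad-x (trans (𝟎≡𝟏⇒≡𝟏 𝟎≡𝟏 (∼ x)) (sym (𝟎≡𝟏⇒≡𝟏 𝟎≡𝟏 x)))

  rad-up : ∀ {x y} → x ≤ y → InRad x → InRad y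
  rad-up x≤y rad-x = aboveNeg⇒rad (rad⇒𝟎≢𝟏 rad-x) (aboveNeg-up x≤y (rad⇒aboveNeg rad-x))

  rad-∧ : ∀ {x z} → InRad x → InRad z → InRad (x ∧ z)
  rad-∧ rad-x rad-z = aboveNeg⇒rad (rad⇒𝟎≢𝟏 rad-x) (aboveNeg-∧ (rad⇒aboveNeg rad-x) (rad⇒aboveNeg rad-z))

  rad-𝟏 : 𝟎 ≢ 𝟏 → InRad 𝟏
  rad-𝟏 𝟎≢𝟏 = aboveNeg⇒rad 𝟎≢𝟏 aboveNeg-𝟏

  ⁺-rad : 𝟎 ≢ 𝟏 → ∀ a → InRad (a ⁺)
  ⁺-rad 𝟎≢𝟏 a = aboveNeg⇒rad 𝟎≢𝟏 (⁺-aboveNeg a)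

  ⁻-rad : 𝟎 ≢ 𝟏 → ∀ a → InRad (a ⁻)
  ⁻-rad 𝟎≢𝟏 a = aboveNeg⇒rad 𝟎≢𝟏 (⁻-aboveNeg a)

  δRad-∧ : ∀ {a b} → InδRad a → InδRad b → InδRad (a ∧ b)
  δRad-∧ (x , rad-x , refl) (z , rad-z , refl) = x ∧ z , rad-∧ rad-x rad-z , ∼∼-∧ x z

  -- The Boolean element e sits below ∼ ((x ∧ s) ²), whose square vanishes.
  boolean∧aboveNeg≤∼aboveNeg⇒≡𝟎 : ∀ {e x s} → e ∨ ∼ e ≡ 𝟏 → AboveNeg x → AboveNeg s →
                                  e ∧ x ≤ ∼ s → e ≡ 𝟎
  boolean∧aboveNeg≤∼aboveNeg⇒≡𝟎 {e} {x} {s} bool above-x above-s e∧x≤∼s = ≤𝟎⇒≡𝟎 (begin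
    e                             ≡⟨ boolean-·-idem bool ⟨
    e · e                         ≤⟨ ·-mono-≤ e≤∼m² e≤∼m² ⟩
    ∼ ((x ∧ s) ²) · ∼ ((x ∧ s) ²) ≡⟨ aboveNeg-∼²·∼²≡𝟎 (aboveNeg-∧ above-x above-s) ⟩
    𝟎                             ∎)
    where
    e≤∼m² : e ≤ ∼ ((x ∧ s) ²)
    e≤∼m² = ·≤𝟎⇒≤∼ (begin
      e · ((x ∧ s) · (x ∧ s)) ≤⟨ ·-monoʳ-≤ (·-mono-≤ (x∧y≤x x s) (x∧y≤y x s)) ⟩
      e · (x · s)             ≡⟨ ·-assoc e x s ⟨
      (e · x) · s             ≡⟨ cong (_· s) (boolean-∧≡· x bool) ⟨
      (e ∧ x) · s             ≤⟨ ·-monoˡ-≤ e∧x≤∼s ⟩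
      ∼ s · s                 ≡⟨ ∼x·x≡𝟎 s ⟩
      𝟎                       ∎)

module Filters (𝐀 : SBPAlgebra) where
  open SBPNotions 𝐀 hiding (_≤_)
  open SBPProperties 𝐀
  open ≤-Reasoning poset

  module Ultrafilter (𝔲 : UltrafilterB) where
    U : Pred Carrier
    U = proj₁ 𝔲

    open IsGenPrimeFilter (proj₁ (proj₂ 𝔲))

    U-boolean : ∀ {a} → U a → InBool a
    U-boolean = sub _

    U-𝟏 : U 𝟏
    U-𝟏 = top

    U-up : ∀ {a b} → U a → InBool b → a ≤ b → U b
    U-up ua bool-b a≤b = up _ _ ua bool-b (sym a≤b)

    U-∧ : ∀ {a b} → U a → U b → U (a ∧ b)
    U-∧ = meet _ _

    U-𝟎 : ¬ U 𝟎
    U-𝟎 u𝟎 with proj₂ (proj₂ 𝔲)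
    ... | c , bool-c , ¬uc = ¬uc (U-up u𝟎 bool-c (𝟎-least c))

    𝟎≢𝟏 : 𝟎 ≢ 𝟏
    𝟎≢𝟏 𝟎≡𝟏 = U-𝟎 (subst U (sym 𝟎≡𝟏) U-𝟏)

    U-ultra : ∀ {u} → InBool u → U u ⊎ U (∼ u)
    U-ultra {u} bool = prime u (∼ u) bool (boolean-∼ bool) (subst U (sym bool) U-𝟏)

    U-∼ : ∀ {u} → U u → ¬ U (∼ u)
    U-∼ uu u∼u = U-𝟎 (subst U (boolean-∧∼≡𝟎 (U-boolean uu)) (U-∧ uu u∼u))

    compatible-∼∨ : ∀ {X e r} → Compatible U X → U e → InRad r → X (∼ e ∨ r) → X r
    compatible-∼∨ {e = e} {r} compat ue rad-r x =
      Sum.fromInj₂ (λ u∼e → ⊥-elim (U-∼ ue u∼e))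
                   (compat (∼ e) r (boolean-∼ (U-boolean ue)) rad-r x)

  module Generated (𝔲 : UltrafilterB) (Z : Pred Carrier)
                   (Z-inhabited : Σ Carrier Z)
                   (Z-∧ : ∀ {z z′} → Z z → Z z′ → Σ Carrier λ w → Z w × w ≤ z ∧ z′)
                   (U∧Z≰𝟎 : ∀ {u z} → Ultrafilter.U 𝔲 u → Z z → ¬ (u ∧ z ≤ 𝟎)) where
    open Ultrafilter 𝔲

    Gen : Pred Carrier
    Gen a = Σ Carrier λ u → Σ Carrier λ z → U u × Z z × u ∧ z ≤ a

    Gen-up : ∀ {a b} → Gen a → a ≤ b → Gen b
    Gen-up (u , z , uu , zz , u∧z≤a) a≤b = u , z , uu , zz , ≤-trans u∧z≤a a≤b

    Gen-∧ : ∀ {a b} → Gen a → Gen b → Gen (a ∧ b)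
    Gen-∧ (u , z , uu , zz , u∧z≤a) (u′ , z′ , uu′ , zz′ , u′∧z′≤b) with Z-∧ zz zz′
    ... | w , zw , w≤z∧z′ = u ∧ u′ , w , U-∧ uu uu′ , zw , ∧-greatest
      (≤-trans (∧-monotonic (x∧y≤x u u′) (≤-trans w≤z∧z′ (x∧y≤x z z′))) u∧z≤a)
      (≤-trans (∧-monotonic (x∧y≤y u u′) (≤-trans w≤z∧z′ (x∧y≤y z z′))) u′∧z′≤b)

    Gen-U : ∀ {u} → U u → Gen u
    Gen-U uu = _ , proj₁ Z-inhabited , uu , proj₂ Z-inhabited , x∧y≤x _ _

    Gen-Z : ∀ {z} → Z z → Gen z
    Gen-Z zz = 𝟏 , _ , U-𝟏 , zz , x∧y≤y _ _

    ¬Gen-𝟎 : ¬ Gen 𝟎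
    ¬Gen-𝟎 (u , z , uu , zz , u∧z≤𝟎) = U∧Z≰𝟎 uu zz u∧z≤𝟎

    Gen-boolean⇒U : ∀ {c} → InBool c → Gen c → U c
    Gen-boolean⇒U {c} bool-c (u , z , uu , zz , u∧z≤c) with U-ultra bool-c
    ... | inj₁ uc = uc
    ... | inj₂ u∼c = ⊥-elim (U∧Z≰𝟎 (U-∧ uu u∼c) zz (begin
      (u ∧ ∼ c) ∧ z ≤⟨ ∧-swap-≤ u (∼ c) z ⟩
      (u ∧ z) ∧ ∼ c ≤⟨ ∧-monotonic u∧z≤c ≤-refl ⟩
      c ∧ ∼ c       ≡⟨ boolean-∧∼≡𝟎 bool-c ⟩
      𝟎             ∎))

    booleanPart≐U : (λ c → InBool c × Gen c) ≐ U
    booleanPart≐U = (λ c (bool-c , gc) → Gen-boolean⇒U bool-c gc) , λ c uc → U-boolean uc , Gen-U uc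

    primeFilter : (∀ a b → Gen (a ∨ b) → Gen a ⊎ Gen b) → PrimeFilterA
    primeFilter Gen-∨ = Gen , isFilter , 𝟎 , tt , ¬Gen-𝟎
      where
      isFilter : IsGenPrimeFilter (λ _ → ⊤) Gen
      isFilter = record
        { sub   = λ _ _ → tt
        ; top   = Gen-U U-𝟏
        ; up    = λ _ _ ga _ a∧b≡a → Gen-up ga (sym a∧b≡a)
        ; meet  = λ _ _ → Gen-∧
        ; prime = λ a b _ _ → Gen-∨ a b
        }

  δ⁻¹-isGenPrimeFilter : ∀ {Y} → IsGenPrimeFilter InδRad Y → IsGenPrimeFilter InRad (δ⁻¹ Y)
  δ⁻¹-isGenPrimeFilter {Y} isY = record
    { sub   = λ _ → proj₁
    ; top   = rad-𝟏 (rad⇒𝟎≢𝟏 (proj₁ (proj₂ (sub 𝟏 top)))) , subst Y (sym ∼∼𝟏≡𝟏) top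
    ; up    = λ a b (_ , ya) rad-b a∧b≡a →
                rad-b , up (δ a) (δ b) ya (b , rad-b , refl) (sym (∼∼-monotone (sym a∧b≡a)))
    ; meet  = λ a b (rad-a , ya) (rad-b , yb) → rad-∧ rad-a rad-b , subst Y (sym (∼∼-∧ a b)) (meet _ _ ya yb)
    ; prime = λ a b rad-a rad-b (_ , ya∨b) → Sum.map (rad-a ,_) (rad-b ,_)
                (prime (δ a) (δ b) (a , rad-a , refl) (b , rad-b , refl) (subst Y (∼∼-∨ a b) ya∨b))
    }
    where
    open IsGenPrimeFilter isY

  module PrimeFilter (F : PrimeFilterA) where
    P : Pred Carrier
    P = proj₁ F

    open IsGenPrimeFilter (proj₁ (proj₂ F))

    P-up : ∀ {a b} → P a → a ≤ b → P b
    P-up pa a≤b = up _ _ pa tt (sym a≤b)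

    P-∧ : ∀ {a b} → P a → P b → P (a ∧ b)
    P-∧ = meet _ _

    P-∨ : ∀ {a b} → P (a ∨ b) → P a ⊎ P b
    P-∨ = prime _ _ tt tt

    P-𝟏 : P 𝟏
    P-𝟏 = top

    P-𝟎 : ¬ P 𝟎
    P-𝟎 p𝟎 with proj₂ (proj₂ F)
    ... | c , _ , ¬pc = ¬pc (P-up p𝟎 (𝟎-least c))

    𝟎≢𝟏 : 𝟎 ≢ 𝟏
    𝟎≢𝟏 𝟎≡𝟏 = P-𝟎 (subst P (sym 𝟎≡𝟏) P-𝟏)

    P-ultra : ∀ {u} → InBool u → P u ⊎ P (∼ u)
    P-ultra bool = P-∨ (subst P (sym bool) P-𝟏)

    P-∼∼∼ : ∀ {x} → P (∼ ∼ ∼ x) → P (∼ x)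
    P-∼∼∼ {x} = subst P (∼∼∼x≡∼x x)

    P-∼⇒∼∼∼ : ∀ {x} → P (∼ x) → P (∼ ∼ ∼ x)
    P-∼⇒∼∼∼ {x} = subst P (sym (∼∼∼x≡∼x x))

    β∧⁺-recover : ∀ {a} → P (β a) → P (a ⁺) → P a
    β∧⁺-recover pβ p⁺ = P-up (P-∧ pβ p⁺) (β∧⁺≤x _)

    booleanPart : UltrafilterB
    booleanPart = (λ u → InBool u × P u) , isFilter , 𝟎 , boolean-𝟎 , λ (_ , p𝟎) → P-𝟎 p𝟎
      where
      isFilter : IsGenPrimeFilter InBool (λ u → InBool u × P u)
      isFilter = record
        { sub   = λ _ → proj₁
        ; top   = boolean-𝟏 , P-𝟏
        ; up    = λ _ _ (_ , pa) bool-b a∧b≡a → bool-b , P-up pa (sym a∧b≡a)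
        ; meet  = λ _ _ (bool-a , pa) (bool-b , pb) → boolean-∧ bool-a bool-b , P-∧ pa pb
        ; prime = λ _ _ bool-a bool-b (_ , p) → Sum.map (bool-a ,_) (bool-b ,_) (P-∨ p)
        }

module Representation (em : ExcludedMiddle 0ℓ) (𝐀 : SBPAlgebra) where
  open SBPNotions 𝐀 hiding (_≤_)
  open SBPProperties 𝐀
  open Filters 𝐀
  open ≤-Reasoning poset

  module Image (F : PrimeFilterA) where
    open PrimeFilter F

    ContainsNegRad : Set
    ContainsNegRad = Σ Carrier λ x → InRad x × P (∼ x)

    radicalPart : GenPrimeFilter InRad
    radicalPart = (λ x → InRad x × P x) , record
      { sub   = λ _ → proj₁
      ; top   = rad-𝟏 𝟎≢𝟏 , P-𝟏
      ; up    = λ _ _ (_ , pa) rad-b a∧b≡a → rad-b , P-up pa (sym a∧b≡a)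
      ; meet  = λ _ _ (rad-a , pa) (rad-b , pb) → rad-∧ rad-a rad-b , P-∧ pa pb
      ; prime = λ _ _ rad-a rad-b (_ , p) → Sum.map (rad-a ,_) (rad-b ,_) (P-∨ p)
      }

    asPositive : F-A
    asPositive = booleanPart , radicalPart ,
      λ _ _ bool-u rad-x (_ , p) → Sum.map (bool-u ,_) (rad-x ,_) (P-∨ p)

    Coradical : Pred Carrier
    Coradical y = InδRad y × ¬ P (∼ y)

    ¬P∼-∧ : ∀ {a b} → ¬ P (∼ a) → ¬ P (∼ b) → ¬ P (∼ (a ∧ b))
    ¬P∼-∧ {a} {b} ¬p∼a ¬p∼b p = [ ¬p∼a , ¬p∼b ] (P-∨ (subst P (deMorgan₁ a b) p))

    ¬P∼-∨ : ∀ {a b} → ¬ P (∼ (a ∨ b)) → ¬ P (∼ a) ⊎ ¬ P (∼ b)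
    ¬P∼-∨ {a} {b} ¬p with em {P (∼ a)} | em {P (∼ b)}
    ... | no ¬p∼a | _        = inj₁ ¬p∼a
    ... | yes _   | no ¬p∼b  = inj₂ ¬p∼b
    ... | yes p∼a | yes p∼b  = ⊥-elim (¬p (subst P (sym (deMorgan₂ a b)) (P-∧ p∼a p∼b)))

    coradicalPart : GenPrimeFilter InδRad
    coradicalPart = Coradical , record
      { sub   = λ _ → proj₁
      ; top   = (𝟏 , rad-𝟏 𝟎≢𝟏 , ∼∼𝟏≡𝟏) , λ p∼𝟏 → P-𝟎 (subst P ∼𝟏≡𝟎 p∼𝟏)
      ; up    = λ _ _ (_ , ¬p∼a) δrad-b a∧b≡a → δrad-b , λ p∼b → ¬p∼a (P-up p∼b (∼-antitone (sym a∧b≡a)))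
      ; meet  = λ _ _ (δrad-a , ¬p∼a) (δrad-b , ¬p∼b) → δRad-∧ δrad-a δrad-b , ¬P∼-∧ ¬p∼a ¬p∼b
      ; prime = λ _ _ δrad-a δrad-b (_ , ¬p) → Sum.map (δrad-a ,_) (δrad-b ,_) (¬P∼-∨ ¬p)
      }

    δ⁻¹Coradical-intro : ∀ {x} → InRad x → ¬ P (∼ x) → δ⁻¹ Coradical x
    δ⁻¹Coradical-intro {x} rad-x ¬p∼x = rad-x , (x , rad-x , refl) , λ p → ¬p∼x (P-∼∼∼ p)

    δ⁻¹Coradical-¬P∼ : ∀ {x} → δ⁻¹ Coradical x → ¬ P (∼ x)
    δ⁻¹Coradical-¬P∼ (_ , _ , ¬p) p∼x = ¬p (P-∼⇒∼∼∼ p∼x)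

    δ⁻¹coradicalPart : IsGenPrimeFilter InRad (δ⁻¹ Coradical)
    δ⁻¹coradicalPart = δ⁻¹-isGenPrimeFilter (proj₂ coradicalPart)

    coradical-compatible : Compatible (proj₁ booleanPart) (δ⁻¹ Coradical)
    coradical-compatible u x bool-u rad-x xu∨x with P-ultra bool-u
    ... | inj₁ pu  = inj₁ (bool-u , pu)
    ... | inj₂ p∼u = inj₂ (δ⁻¹Coradical-intro rad-x λ p∼x →
                       δ⁻¹Coradical-¬P∼ xu∨x (subst P (sym (deMorgan₂ u x)) (P-∧ p∼u p∼x)))

    asNegative : ContainsNegRad → F-A∂
    asNegative (x , rad-x , p∼x) =
      booleanPart , coradicalPart , δ⁻¹coradicalPart , coradical-compatible ,
      λ (R⊆ , _) → δ⁻¹Coradical-¬P∼ (R⊆ x rad-x) p∼x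

    ¬containsNegRad⇒β : ¬ ContainsNegRad → ∀ {a} → P a → P (β a)
    ¬containsNegRad⇒β ¬neg {a} pa = Sum.fromInj₁
      (λ p∼β → ⊥-elim (¬neg (a ⁻ , ⁻-rad 𝟎≢𝟏 a , P-up (P-∧ pa p∼β) (x∧∼β≤∼⁻ a))))
      (P-ultra (β-boolean a))

    containsNegRad⇒rad : ContainsNegRad → ∀ {z} → InRad z → P z
    containsNegRad⇒rad (x , rad-x , p∼x) rad-z =
      P-up p∼x (aboveNeg-∼≤ (rad⇒aboveNeg rad-x) (rad⇒aboveNeg rad-z))

  image : (F : PrimeFilterA) → Dec (Image.ContainsNegRad F) → F⋈
  image F (yes neg) = +⟨ Image.asNegative F neg ⟩
  image F (no _)    = ⟨ Image.asPositive F ⟩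

  module _ (F H : PrimeFilterA) where
    private
      module PF = PrimeFilter F
      module PH = PrimeFilter H
      module IF = Image F
      module IH = Image H

    booleanPart-≐ : PF.P ⊆ PH.P → proj₁ PF.booleanPart ≐ proj₁ PH.booleanPart
    booleanPart-≐ F⊆H = (λ u (bool-u , pu) → bool-u , F⊆H u pu) , H⊆F
      where
      H⊆F : proj₁ PH.booleanPart ⊆ proj₁ PF.booleanPart
      H⊆F u (bool-u , hu) with PF.P-ultra bool-u
      ... | inj₁ pu  = bool-u , pu
      ... | inj₂ p∼u = ⊥-elim (PH.P-𝟎 (PH.P-up (PH.P-∧ hu (F⊆H _ p∼u)) (≤-reflexive (boolean-∧∼≡𝟎 bool-u))))

    β-transfer : proj₁ PF.booleanPart ≐ proj₁ PH.booleanPart → ∀ {a} → PF.P (β a) → PH.P (β a)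
    β-transfer (F⊆H , _) {a} pβ = proj₂ (F⊆H _ (β-boolean a , pβ))

    image-monotone : ∀ dF dH → PF.P ⊆ PH.P → image F dF ⊑ image H dH
    image-monotone (yes _) (yes _) F⊆H =
      booleanPart-≐ F⊆H , λ y (δrad-y , ¬h∼y) → δrad-y , λ p∼y → ¬h∼y (F⊆H _ p∼y)
    image-monotone (yes (x , rad-x , p∼x)) (no ¬negH) F⊆H = ⊥-elim (¬negH (x , rad-x , F⊆H _ p∼x))
    image-monotone (no _) (yes _) F⊆H = booleanPart-≐ F⊆H
    image-monotone (no _) (no _) F⊆H =
      booleanPart-≐ F⊆H , λ x (rad-x , px) → rad-x , F⊆H x px

    image-reflects : ∀ dF dH → image F dF ⊑ image H dH → PF.P ⊆ PH.P
    image-reflects (no ¬negF) (no _) (U≐ , X⊆) a pa =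
      PH.β∧⁺-recover (β-transfer U≐ (IF.¬containsNegRad⇒β ¬negF pa))
                     (proj₂ (X⊆ _ (⁺-rad PF.𝟎≢𝟏 a , PF.P-up pa (x≤x∨y a _))))
    image-reflects (no ¬negF) (yes negH) U≐ a pa =
      PH.β∧⁺-recover (β-transfer U≐ (IF.¬containsNegRad⇒β ¬negF pa))
                     (IH.containsNegRad⇒rad negH (⁺-rad PF.𝟎≢𝟏 a))
    image-reflects (yes _) (no _) ()
    image-reflects (yes _) (yes negH) (U≐ , Y⊇) a pa = cases (PF.P-ultra (β-boolean a)) em
      where
      cases : PF.P (β a) ⊎ PF.P (∼ β a) → Dec (PH.P (∼ (a ⁻))) → PH.P a
      cases (inj₁ pβ) _ = PH.β∧⁺-recover (β-transfer U≐ pβ) (IH.containsNegRad⇒rad negH (⁺-rad PF.𝟎≢𝟏 a))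
      cases (inj₂ _) (yes h∼⁻) = PH.P-up h∼⁻ (∼⁻≤x a)
      cases (inj₂ p∼β) (no ¬h∼⁻) =
        ⊥-elim (proj₂ (Y⊇ _ ((a ⁻ , ⁻-rad PF.𝟎≢𝟏 a , refl) , λ h → ¬h∼⁻ (PH.P-∼∼∼ h)))
                      (PF.P-∼⇒∼∼∼ (PF.P-up (PF.P-∧ pa p∼β) (x∧∼β≤∼⁻ a))))

  module FromPositive (p : F-A) where
    𝔲 : UltrafilterB
    𝔲 = proj₁ p

    open Ultrafilter 𝔲

    X : Pred Carrier
    X = proj₁ (proj₁ (proj₂ p))

    private
      module X-filter = IsGenPrimeFilter (proj₂ (proj₁ (proj₂ p)))

    compatible : Compatible U X
    compatible = proj₂ (proj₂ p)

    X-closed : ∀ {e x r} → U e → X x → InRad r → e ∧ x ≤ r → X r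
    X-closed {e} {x} {r} ue xx rad-r e∧x≤r = compatible-∼∨ compatible ue rad-r
      (X-filter.up x _ xx (rad-up (y≤x∨y _ r) rad-r) (sym (boolean-shunt (U-boolean ue) e∧x≤r)))

    U∧X≰∼aboveNeg : ∀ {e x s} → U e → X x → AboveNeg s → ¬ (e ∧ x ≤ ∼ s)
    U∧X≰∼aboveNeg ue xx above-s e∧x≤∼s = U-𝟎 (subst U
      (boolean∧aboveNeg≤∼aboveNeg⇒≡𝟎 (U-boolean ue) (rad⇒aboveNeg (X-filter.sub _ xx)) above-s e∧x≤∼s) ue)

    X-∧ : ∀ {x x′} → X x → X x′ → Σ Carrier λ w → X w × w ≤ x ∧ x′
    X-∧ xx xx′ = _ , X-filter.meet _ _ xx xx′ , ≤-refl

    U∧X≰𝟎 : ∀ {u x} → U u → X x → ¬ (u ∧ x ≤ 𝟎)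
    U∧X≰𝟎 uu xx u∧x≤𝟎 = U∧X≰∼aboveNeg uu xx aboveNeg-𝟏 (≤-trans u∧x≤𝟎 (≤-reflexive (sym ∼𝟏≡𝟎)))

    open Generated 𝔲 X (𝟏 , X-filter.top) X-∧ U∧X≰𝟎

    Gen-β∧⁺ : ∀ {a} → U (β a) → X (a ⁺) → Gen a
    Gen-β∧⁺ {a} uβ x⁺ = β a , a ⁺ , uβ , x⁺ , β∧⁺≤x a

    Gen-∨ : ∀ a b → Gen (a ∨ b) → Gen a ⊎ Gen b
    Gen-∨ a b (u , x , uu , xx , u∧x≤a∨b) = cases (U-ultra (β-boolean a)) (U-ultra (β-boolean b))
      where
      cases : U (β a) ⊎ U (∼ β a) → U (β b) ⊎ U (∼ β b) → Gen a ⊎ Gen b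
      cases (inj₁ uβa) (inj₁ uβb) = Sum.map (Gen-β∧⁺ uβa) (Gen-β∧⁺ uβb)
        (X-filter.prime _ _ (⁺-rad 𝟎≢𝟏 a) (⁺-rad 𝟎≢𝟏 b)
          (X-closed uu xx (rad-up (x≤x∨y _ _) (⁺-rad 𝟎≢𝟏 a))
            (≤-trans u∧x≤a∨b (∨-monotonic (x≤x∨y a _) (x≤x∨y b _)))))
      cases (inj₁ uβa) (inj₂ u∼βb) = inj₁ (Gen-β∧⁺ uβa
        (X-closed (U-∧ uu u∼βb) xx (⁺-rad 𝟎≢𝟏 a) (≤-trans (∧-swap-≤ u _ x) (≤∨⇒∧∼β≤⁺ u∧x≤a∨b))))
      cases (inj₂ u∼βa) (inj₁ uβb) = inj₂ (Gen-β∧⁺ uβb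
        (X-closed (U-∧ uu u∼βa) xx (⁺-rad 𝟎≢𝟏 b)
          (≤-trans (∧-swap-≤ u _ x) (≤∨⇒∧∼β≤⁺ (≤-trans u∧x≤a∨b (≤-reflexive (∨-comm a b)))))))
      cases (inj₂ u∼βa) (inj₂ u∼βb) = ⊥-elim (U∧X≰∼aboveNeg (U-∧ uu (U-∧ u∼βa u∼βb)) xx
        (aboveNeg-∧ (⁻-aboveNeg a) (⁻-aboveNeg b))
        (≤-trans (∧-swap-≤ u _ x) (≤∨⇒∧∼β∧∼β≤∼[⁻∧⁻] u∧x≤a∨b)))

    filter : PrimeFilterA
    filter = primeFilter Gen-∨

    ¬containsNegRad : ¬ Image.ContainsNegRad filter
    ¬containsNegRad (s , rad-s , (u , x , uu , xx , u∧x≤∼s)) =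
      U∧X≰∼aboveNeg uu xx (rad⇒aboveNeg rad-s) u∧x≤∼s

    image-filter : ∀ d → (image filter d ⊑ ⟨ p ⟩) × (⟨ p ⟩ ⊑ image filter d)
    image-filter (yes neg) = ⊥-elim (¬containsNegRad neg)
    image-filter (no _) =
      (booleanPart≐U , λ r (rad-r , (u , x , uu , xx , u∧x≤r)) → X-closed uu xx rad-r u∧x≤r) ,
      (swap booleanPart≐U , λ r xr → X-filter.sub r xr , Gen-Z xr)

  module FromNegative (q : F-A∂) where
    𝔲 : UltrafilterB
    𝔲 = proj₁ q

    open Ultrafilter 𝔲

    Y : Pred Carrier
    Y = proj₁ (proj₁ (proj₂ q))

    X : Pred Carrier
    X = δ⁻¹ Y

    private
      module Y-filter = IsGenPrimeFilter (proj₂ (proj₁ (proj₂ q)))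
      module X-filter = IsGenPrimeFilter (proj₁ (proj₂ (proj₂ q)))

    compatible : Compatible U X
    compatible = proj₁ (proj₂ (proj₂ (proj₂ q)))

    X≉R : ¬ (InRad ≐ X)
    X≉R = proj₂ (proj₂ (proj₂ (proj₂ q)))

    Outside : Pred Carrier
    Outside s = InRad s × ¬ X s

    outside-witness : Σ Carrier Outside
    outside-witness with em {Σ Carrier Outside}
    ... | yes outside = outside
    ... | no ∄outside = ⊥-elim (X≉R (R⊆X , X-filter.sub))
      where
      R⊆X : InRad ⊆ X
      R⊆X r rad-r with em {X r}
      ... | yes xr = xr
      ... | no ¬xr = ⊥-elim (∄outside (r , rad-r , ¬xr))

    s₀ : Carrier
    s₀ = proj₁ outside-witness

    outside-s₀ : Outside s₀
    outside-s₀ = proj₂ outside-witness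

    -- Since X = δ⁻¹ Y with Y up-closed, e ∧ ∼ s ≤ ∼ t puts ∼ e ∨ s into X, and compatibility
    -- then forces s into X.
    U∧∼Outside≰∼X : ∀ {e s t} → U e → Outside s → X t → ¬ (e ∧ ∼ s ≤ ∼ t)
    U∧∼Outside≰∼X {e} {s} {t} ue (rad-s , ¬xs) xt e∧∼s≤∼t =
      ¬xs (compatible-∼∨ compatible ue rad-s
            (rad-∼e∨s , Y-filter.up (δ t) _ (proj₂ xt) (_ , rad-∼e∨s , refl) (sym δt≤δ[∼e∨s])))
      where
      rad-∼e∨s : InRad (∼ e ∨ s)
      rad-∼e∨s = rad-up (y≤x∨y _ s) rad-s

      δt≤δ[∼e∨s] : ∼ ∼ t ≤ ∼ ∼ (∼ e ∨ s)
      δt≤δ[∼e∨s] = begin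
        ∼ ∼ t           ≤⟨ ∼-antitone e∧∼s≤∼t ⟩
        ∼ (e ∧ ∼ s)     ≡⟨ cong ∼_ (cong (_∧ ∼ s) (boolean-∼∼ (U-boolean ue))) ⟨
        ∼ (∼ ∼ e ∧ ∼ s) ≡⟨ cong ∼_ (deMorgan₂ (∼ e) s) ⟨
        ∼ ∼ (∼ e ∨ s)   ∎

    NegOutside : Pred Carrier
    NegOutside z = Σ Carrier λ s → Outside s × ∼ s ≡ z

    negOutside-∧ : ∀ {z z′} → NegOutside z → NegOutside z′ → Σ Carrier λ w → NegOutside w × w ≤ z ∧ z′
    negOutside-∧ (s , (rad-s , ¬xs) , refl) (s′ , (rad-s′ , ¬xs′) , refl) =
      ∼ (s ∨ s′) , (s ∨ s′ , (rad-up (x≤x∨y s s′) rad-s , ¬xs∨s′) , refl) , ≤-reflexive (deMorgan₂ s s′)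
      where
      ¬xs∨s′ : ¬ X (s ∨ s′)
      ¬xs∨s′ xs∨s′ = [ ¬xs , ¬xs′ ] (X-filter.prime s s′ rad-s rad-s′ xs∨s′)

    U∧NegOutside≰𝟎 : ∀ {u z} → U u → NegOutside z → ¬ (u ∧ z ≤ 𝟎)
    U∧NegOutside≰𝟎 uu (s , outside-s , refl) u∧∼s≤𝟎 =
      U∧∼Outside≰∼X uu outside-s X-filter.top (≤-trans u∧∼s≤𝟎 (≤-reflexive (sym ∼𝟏≡𝟎)))

    open Generated 𝔲 NegOutside (∼ s₀ , s₀ , outside-s₀ , refl) negOutside-∧ U∧NegOutside≰𝟎

    Gen-β : ∀ {a} → U (β a) → Gen a
    Gen-β {a} uβ = β a , ∼ s₀ , uβ , (s₀ , outside-s₀ , refl) , (begin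
      β a ∧ ∼ s₀ ≤⟨ ∧-monotonic ≤-refl (aboveNeg-∼≤ (rad⇒aboveNeg (proj₁ outside-s₀)) (⁺-aboveNeg a)) ⟩
      β a ∧ a ⁺  ≤⟨ β∧⁺≤x a ⟩
      a          ∎)

    Gen-∼β : ∀ {a} → U (∼ β a) → ¬ X (a ⁻) → Gen a
    Gen-∼β {a} u∼β ¬x⁻ =
      ∼ β a , ∼ (a ⁻) , u∼β , (a ⁻ , (⁻-rad 𝟎≢𝟏 a , ¬x⁻) , refl) , ≤-trans (x∧y≤y _ _) (∼⁻≤x a)

    Gen-∨ : ∀ a b → Gen (a ∨ b) → Gen a ⊎ Gen b
    Gen-∨ a b (u , _ , uu , (s , outside-s , refl) , u∧∼s≤a∨b) =
      cases (U-ultra (β-boolean a)) (U-ultra (β-boolean b)) em em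
      where
      cases : U (β a) ⊎ U (∼ β a) → U (β b) ⊎ U (∼ β b) → Dec (X (a ⁻)) → Dec (X (b ⁻)) → Gen a ⊎ Gen b
      cases (inj₁ uβa) _           _          _          = inj₁ (Gen-β uβa)
      cases (inj₂ _)   (inj₁ uβb)  _          _          = inj₂ (Gen-β uβb)
      cases (inj₂ u∼βa) (inj₂ _)   (no ¬xa⁻)  _          = inj₁ (Gen-∼β u∼βa ¬xa⁻)
      cases (inj₂ _)   (inj₂ u∼βb) (yes _)    (no ¬xb⁻)  = inj₂ (Gen-∼β u∼βb ¬xb⁻)
      cases (inj₂ u∼βa) (inj₂ u∼βb) (yes xa⁻) (yes xb⁻) = ⊥-elim (U∧∼Outside≰∼X
        (U-∧ uu (U-∧ u∼βa u∼βb)) outside-s (X-filter.meet _ _ xa⁻ xb⁻)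
        (≤-trans (∧-swap-≤ u _ (∼ s)) (≤∨⇒∧∼β∧∼β≤∼[⁻∧⁻] u∧∼s≤a∨b)))

    filter : PrimeFilterA
    filter = primeFilter Gen-∨

    coradical≐Y : Image.Coradical filter ≐ Y
    coradical≐Y = Coradical⊆Y , λ y yy → Y-filter.sub y yy , Y⇒¬Gen∼ (Y-filter.sub y yy) yy
      where
      Y⇒¬Gen∼ : ∀ {y} → InδRad y → Y y → ¬ Gen (∼ y)
      Y⇒¬Gen∼ (x , rad-x , refl) yy (_ , _ , uu , (s , outside-s , refl) , u∧∼s≤∼y) =
        U∧∼Outside≰∼X uu outside-s (rad-x , yy) (≤-trans u∧∼s≤∼y (≤-reflexive (∼∼∼x≡∼x x)))

      Coradical⊆Y : Image.Coradical filter ⊆ Y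
      Coradical⊆Y _ ((x , rad-x , refl) , ¬gen) with em {Y (δ x)}
      ... | yes yy = yy
      ... | no ¬yy = ⊥-elim (¬gen (Gen-Z (x , (rad-x , λ xx → ¬yy (proj₂ xx)) , sym (∼∼∼x≡∼x x))))

    image-filter : ∀ d → (image filter d ⊑ +⟨ q ⟩) × (+⟨ q ⟩ ⊑ image filter d)
    image-filter (no ¬neg) = ⊥-elim (¬neg (s₀ , proj₁ outside-s₀ , Gen-Z (s₀ , outside-s₀ , refl)))
    image-filter (yes _) = (booleanPart≐U , proj₂ coradical≐Y) , (swap booleanPart≐U , proj₁ coradical≐Y)

  orderIso : OrderIso _⊆ₚ_ _⊑_
  orderIso = record
    { to         = λ F → image F em
    ; preserves  = λ F H → image-monotone F H em em
    ; reflects   = λ F H → image-reflects F H em em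
    ; surjective = λ { ⟨ p ⟩  → FromPositive.filter p , FromPositive.image-filter p em
                     ; +⟨ q ⟩ → FromNegative.filter q , FromNegative.image-filter q em }
    }

theorem4p19 : ExcludedMiddle 0ℓ → (𝐀 : SBPAlgebra) →
    OrderIso (SBPNotions._⊆ₚ_ 𝐀) (SBPNotions._⊑_ 𝐀)
theorem4p19 em 𝐀 = Representation.orderIso em 𝐀
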